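{- Let $\mathcal O_{ -7,-11}=\mathbb Z\oplus\mathbb Z\omega_1\oplus\mathbb Z\omega_2\oplus\mathbb Z\omega_3\subset\mathcal H_{ -7,-11}$ with $\omega_1=\frac{1+j}2$, $\omega_2=\frac{i+ij}2$, $\omega_3=\frac{2j+ij}{11}$. There is no congruence pair $(m,H)$ of $\mathcal O_{ -7,-11}$ with $m$ an odd prime.
   Context: $\mathcal H_{ -7,-11}$ is the quaternion algebra over $\mathbb Q$ with basis $1,i,j,ij$, $i^2=-7$, $j^2=-11$, $ij=-ji$; $\mathcal O_{ -7,-11}$ is a maximal order. For a commutative ring $A$, $\mathcal G(A)=(\mathcal O_{ -7,-11}\otimes A)^\times/A^\times$. $\phi_m:\mathcal G(\mathbb Z)\to\mathcal G(\mathbb Z/m\mathbb Z)$ is induced by reducing coordinates with respect to $1,\omega_1,\omega_2,\omega_3$ modulo $m$. A congruence pair is $(m,H)$, $m$ a positive integer, $H\le\mathcal G(\mathbb Z/m\mathbb Z)$, such that $\phi_m$ is injective on $\mathcal G(\mathbb Z)$, $H\cap\phi_m(\mathcal G(\mathbb Z))=\{1\}$ and $\phi_m(\mathcal G(\mathbb Z))\cdot H=\mathcal G(\mathbb Z/m\mathbb Z)$. -}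

module Defs where

open import Data.Nat using (ℕ)
open import Data.Integer using (ℤ; +_; -_; _+_; _*_; _-_)
open import Data.Integer.Divisibility using (_∣_)
open import Data.Product using (Σ; _×_)
open import Relation.Binary.PropositionalEquality using (_≡_)

-- Elements of O_{-7,-11} ⊗ ℤ written in the ℤ-basis 1, ω₁, ω₂, ω₃,
-- ω₁ = (1+j)/2, ω₂ = (i+ij)/2, ω₃ = (2j+ij)/11 in H_{-7,-11} (i²=-7, j²=-11, ij=-ji).
-- For A = ℤ/mℤ we use the same integer coordinate vectors, compared modulo m;
-- the reduction map φ_m is then the identity on coordinate vectors.
record O : Set where
  constructor ⟨_,_,_,_⟩
  field
    c0 c1 c2 c3 : ℤ

open O public

-- Multiplication of O, via the structure constants of the basis 1, ω₁, ω₂, ω₃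
-- (computed from the quaternion multiplication; all are integers).
_·_ : O → O → O
⟨ x0 , x1 , x2 , x3 ⟩ · ⟨ y0 , y1 , y2 , y3 ⟩ =
  ⟨ (+ 1) * x0 * y0 + (- (+ 3)) * x1 * y1 + (- (+ 6)) * x1 * y2 + (- (+ 2)) * x1 * y3 + (+ 6) * x2 * y1 + (- (+ 21)) * x2 * y2 + (- (+ 1)) * x2 * y3 + (- (+ 6)) * x3 * y2 + (- (+ 1)) * x3 * y3
  , (+ 1) * x0 * y1 + (+ 1) * x1 * y0 + (+ 1) * x1 * y1 + (+ 12) * x1 * y2 + (+ 2) * x1 * y3 + (- (+ 12)) * x2 * y1 + (- (+ 5)) * x2 * y3 + (- (+ 2)) * x3 * y1 + (+ 5) * x3 * y2
  , (+ 1) * x0 * y2 + (+ 6) * x1 * y2 + (+ 1) * x1 * y3 + (+ 1) * x2 * y0 + (- (+ 5)) * x2 * y1 + (- (+ 2)) * x2 * y3 + (- (+ 1)) * x3 * y1 + (+ 2) * x3 * y2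
  , (+ 1) * x0 * y3 + (- (+ 33)) * x1 * y2 + (- (+ 5)) * x1 * y3 + (+ 33) * x2 * y1 + (+ 12) * x2 * y3 + (+ 1) * x3 * y0 + (+ 6) * x3 * y1 + (- (+ 12)) * x3 * y2 ⟩

infixl 7 _·_

oneO : O
oneO = ⟨ + 1 , + 0 , + 0 , + 0 ⟩

scale : ℤ → O → O
scale l ⟨ x0 , x1 , x2 , x3 ⟩ = ⟨ l * x0 , l * x1 , l * x2 , l * x3 ⟩

infix 4 _≈[_]_ _≡O[_]_

_≈[_]_ : ℤ → ℕ → ℤ → Set
a ≈[ m ] b = (+ m) ∣ (a - b)

_≡O[_]_ : O → ℕ → O → Set
x ≡O[ m ] y = (c0 x ≈[ m ] c0 y) × (c1 x ≈[ m ] c1 y) × (c2 x ≈[ m ] c2 y) × (c3 x ≈[ m ] c3 y)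

IsUnitℤ : O → Set
IsUnitℤ x = Σ O (λ y → (x · y ≡ oneO) × (y · x ≡ oneO))

IsUnitMod : ℕ → O → Set
IsUnitMod m x = Σ O (λ y → (x · y ≡O[ m ] oneO) × (y · x ≡O[ m ] oneO))

-- equality in G(ℤ) = O^× / ℤ^× : x = λ y with λ ∈ ℤ^×
EqGℤ : O → O → Set
EqGℤ x y = Σ ℤ (λ l → Σ ℤ (λ l' → l * l' ≡ + 1) × (x ≡ scale l y))

-- equality in G(ℤ/mℤ) = (O ⊗ ℤ/mℤ)^× / (ℤ/mℤ)^× : x = λ y with λ ∈ (ℤ/mℤ)^×
EqGMod : ℕ → O → O → Set
EqGMod m x y = Σ ℤ (λ l → Σ ℤ (λ l' → l * l' ≈[ m ] + 1) × (x ≡O[ m ] scale l y))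

-- A subgroup of G(ℤ/mℤ), given as a subset of representatives in (O ⊗ ℤ/mℤ)^×
-- which is closed under the equality of G(ℤ/mℤ).
record IsSubgroupG (m : ℕ) (H : O → Set) : Set where
  field
    units   : ∀ x → H x → IsUnitMod m x
    respect : ∀ x y → IsUnitMod m y → EqGMod m x y → H x → H y
    has-one : H oneO
    mul-cl  : ∀ x y → H x → H y → H (x · y)
    inv-cl  : ∀ x y → H x → (x · y ≡O[ m ] oneO) → (y · x ≡O[ m ] oneO) → H y

record CongruencePair (m : ℕ) (H : O → Set) : Set where
  field
    subgroup  : IsSubgroupG m H
    injective : ∀ x y → IsUnitℤ x → IsUnitℤ y → EqGMod m x y → EqGℤ x y
    trivial-∩ : ∀ x → IsUnitℤ x → H x → EqGMod m x oneO
    product   : ∀ z → IsUnitMod m z →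
                Σ O (λ x → IsUnitℤ x × Σ O (λ h → H h × EqGMod m z (x · h)))

-- O^× = {±1, ±ω₃}: the reduced norm is positive definite, as
--   4 N(a + b ω₁ + c ω₂ + d ω₃) = (2a + b)² + (2b + 7c + 2d)² + 7 ((b − 2c)² + c²),
-- so N = 1 forces b = c = 0 and a² + d² = 1. Hence G(ℤ) = {1, ω₃}, and ω₃² = −1.
-- For odd m, 1 + ω₃ is a unit modulo m because (1 + ω₃)(1 − ω₃) = 2. If (m, H) were a
-- congruence pair, then 1 + ω₃ = x h with x ∈ G(ℤ) and h ∈ H, so h = x⁻¹ (1 + ω₃) is the
-- class of 1 + ω₃ or of ω₃ (1 + ω₃) = −1 + ω₃. Both square to ±2 ω₃, which is ω₃ in
-- G(ℤ/mℤ); so ω₃ ∈ H ∩ φ_m(G(ℤ)), although ω₃ ≠ 1 in G(ℤ/mℤ) as m > 1.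

{-# OPTIONS --safe #-}
module Submission where

open import Defs
open import Data.Nat using (ℕ)
open import Data.Nat.Divisibility using (_∣_)
open import Data.Nat.Primality using (Prime)
open import Relation.Nullary using (¬_)

open import Data.Empty using (⊥; ⊥-elim)
open import Data.Fin using (#_)
open import Data.Integer using (ℤ; +_; -[1+_]; -_; _+_; _*_; _-_; 0ℤ; +≤+; ∣_∣; _≤_)
import Data.Integer.Divisibility.Signed as ℤ
import Data.Integer.Properties as ℤ
open import Data.Integer.Solver using (module +-*-Solver)
open import Data.Integer.Tactic.RingSolver using (solve-∀)
import Data.Nat as ℕ
import Data.Nat.Divisibility as ℕ
import Data.Nat.Primality as ℕ
import Data.Nat.Properties as ℕ
open import Data.Product using (∃; _×_; _,_)
open import Data.Sum using (_⊎_; inj₁; inj₂; [_,_]′)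
open import Data.Vec using (Vec; []; _∷_)
open import Function using (_∘_)
open import Level using (0ℓ)
open import Relation.Binary.Bundles using (Setoid)
open import Relation.Binary.PropositionalEquality
import Relation.Binary.Reasoning.Setoid as SetoidReasoning

open +-*-Solver using (Polynomial; con; var; _:+_; _:*_; ⟦_⟧; ⟦_⟧↓; prove)

private
  variable
    m n : ℕ
    k : ℤ
    x y : O

infixl 6 _+ᴼ_
_+ᴼ_ : O → O → O
⟨ x₀ , x₁ , x₂ , x₃ ⟩ +ᴼ ⟨ y₀ , y₁ , y₂ , y₃ ⟩ = ⟨ x₀ + y₀ , x₁ + y₁ , x₂ + y₂ , x₃ + y₃ ⟩

-- The reduced norm of a + b ω₁ + c ω₂ + d ω₃.
norm : O → ℤ
norm ⟨ a , b , c , d ⟩ = a * a + a * b + + 3 * b * b + + 2 * b * d + + 21 * c * c + + 7 * c * d + d * d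

ω₃ : O
ω₃ = ⟨ + 0 , + 0 , + 0 , + 1 ⟩

⟨⟩-cong : ∀ {a₀ a₁ a₂ a₃ b₀ b₁ b₂ b₃} → a₀ ≡ b₀ → a₁ ≡ b₁ → a₂ ≡ b₂ → a₃ ≡ b₃ →
          ⟨ a₀ , a₁ , a₂ , a₃ ⟩ ≡ ⟨ b₀ , b₁ , b₂ , b₃ ⟩
⟨⟩-cong refl refl refl refl = refl

-- The reflective solver cannot see through
-- _·_, so its multiplication table is copied into _·ᴾ_; then ⟦ X ·ᴾ Y ⟧ᴼ ρ is definitionally
-- ⟦ X ⟧ᴼ ρ · ⟦ Y ⟧ᴼ ρ, and identities in O are decided by +-*-Solver.prove.
record Oᴾ (n : ℕ) : Set where
  constructor ⟪_,_,_,_⟫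
  field
    p₀ p₁ p₂ p₃ : Polynomial n

open Oᴾ

infixl 7 _·ᴾ_
infixl 6 _+ᴾ_

_·ᴾ_ : Oᴾ n → Oᴾ n → Oᴾ n
⟪ x0 , x1 , x2 , x3 ⟫ ·ᴾ ⟪ y0 , y1 , y2 , y3 ⟫ =
  ⟪ con (+ 1) :* x0 :* y0 :+ con (- (+ 3)) :* x1 :* y1 :+ con (- (+ 6)) :* x1 :* y2 :+ con (- (+ 2)) :* x1 :* y3 :+ con (+ 6) :* x2 :* y1 :+ con (- (+ 21)) :* x2 :* y2 :+ con (- (+ 1)) :* x2 :* y3 :+ con (- (+ 6)) :* x3 :* y2 :+ con (- (+ 1)) :* x3 :* y3
  , con (+ 1) :* x0 :* y1 :+ con (+ 1) :* x1 :* y0 :+ con (+ 1) :* x1 :* y1 :+ con (+ 12) :* x1 :* y2 :+ con (+ 2) :* x1 :* y3 :+ con (- (+ 12)) :* x2 :* y1 :+ con (- (+ 5)) :* x2 :* y3 :+ con (- (+ 2)) :* x3 :* y1 :+ con (+ 5) :* x3 :* y2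
  , con (+ 1) :* x0 :* y2 :+ con (+ 6) :* x1 :* y2 :+ con (+ 1) :* x1 :* y3 :+ con (+ 1) :* x2 :* y0 :+ con (- (+ 5)) :* x2 :* y1 :+ con (- (+ 2)) :* x2 :* y3 :+ con (- (+ 1)) :* x3 :* y1 :+ con (+ 2) :* x3 :* y2
  , con (+ 1) :* x0 :* y3 :+ con (- (+ 33)) :* x1 :* y2 :+ con (- (+ 5)) :* x1 :* y3 :+ con (+ 33) :* x2 :* y1 :+ con (+ 12) :* x2 :* y3 :+ con (+ 1) :* x3 :* y0 :+ con (+ 6) :* x3 :* y1 :+ con (- (+ 12)) :* x3 :* y2 ⟫

_+ᴾ_ : Oᴾ n → Oᴾ n → Oᴾ n
⟪ x0 , x1 , x2 , x3 ⟫ +ᴾ ⟪ y0 , y1 , y2 , y3 ⟫ = ⟪ x0 :+ y0 , x1 :+ y1 , x2 :+ y2 , x3 :+ y3 ⟫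

scaleᴾ : Polynomial n → Oᴾ n → Oᴾ n
scaleᴾ l ⟪ x0 , x1 , x2 , x3 ⟫ = ⟪ l :* x0 , l :* x1 , l :* x2 , l :* x3 ⟫

oneᴾ : Oᴾ n
oneᴾ = ⟪ con (+ 1) , con (+ 0) , con (+ 0) , con (+ 0) ⟫

normᴾ : Oᴾ n → Polynomial n
normᴾ ⟪ a , b , c , d ⟫ =
  a :* a :+ a :* b :+ con (+ 3) :* b :* b :+ con (+ 2) :* b :* d :+ con (+ 21) :* c :* c :+ con (+ 7) :* c :* d :+ d :* d

⟦_⟧ᴼ : Oᴾ n → Vec ℤ n → O
⟦ ⟪ a , b , c , d ⟫ ⟧ᴼ ρ = ⟨ ⟦ a ⟧ ρ , ⟦ b ⟧ ρ , ⟦ c ⟧ ρ , ⟦ d ⟧ ρ ⟩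

proveᴼ : ∀ (ρ : Vec ℤ n) L R →
         ⟦ p₀ L ⟧↓ ρ ≡ ⟦ p₀ R ⟧↓ ρ → ⟦ p₁ L ⟧↓ ρ ≡ ⟦ p₁ R ⟧↓ ρ →
         ⟦ p₂ L ⟧↓ ρ ≡ ⟦ p₂ R ⟧↓ ρ → ⟦ p₃ L ⟧↓ ρ ≡ ⟦ p₃ R ⟧↓ ρ → ⟦ L ⟧ᴼ ρ ≡ ⟦ R ⟧ᴼ ρ
proveᴼ ρ L R e₀ e₁ e₂ e₃ =
  ⟨⟩-cong (prove ρ (p₀ L) (p₀ R) e₀) (prove ρ (p₁ L) (p₁ R) e₁)
          (prove ρ (p₂ L) (p₂ R) e₂) (prove ρ (p₃ L) (p₃ R) e₃)

env : ℤ → ℤ → O → O → O → Vec ℤ 14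
env k l x y z = k ∷ l ∷ c0 x ∷ c1 x ∷ c2 x ∷ c3 x ∷ c0 y ∷ c1 y ∷ c2 y ∷ c3 y ∷ c0 z ∷ c1 z ∷ c2 z ∷ c3 z ∷ []

K L : Polynomial 14
K = var (# 0)
L = var (# 1)

X Y Z : Oᴾ 14
X = ⟪ var (# 2) , var (# 3) , var (# 4) , var (# 5) ⟫
Y = ⟪ var (# 6) , var (# 7) , var (# 8) , var (# 9) ⟫
Z = ⟪ var (# 10) , var (# 11) , var (# 12) , var (# 13) ⟫

norm-· : ∀ x y → norm (x · y) ≡ norm x * norm y
norm-· x y = prove (env 0ℤ 0ℤ x y y) (normᴾ (X ·ᴾ Y)) (normᴾ X :* normᴾ Y) refl

·-assoc : ∀ x y z → (x · y) · z ≡ x · (y · z)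
·-assoc x y z = proveᴼ (env 0ℤ 0ℤ x y z) ((X ·ᴾ Y) ·ᴾ Z) (X ·ᴾ (Y ·ᴾ Z)) refl refl refl refl

·-identityˡ : ∀ x → oneO · x ≡ x
·-identityˡ x = proveᴼ (env 0ℤ 0ℤ x x x) (oneᴾ ·ᴾ X) X refl refl refl refl

scale-·ˡ : ∀ k x y → scale k x · y ≡ scale k (x · y)
scale-·ˡ k x y = proveᴼ (env k 0ℤ x y y) (scaleᴾ K X ·ᴾ Y) (scaleᴾ K (X ·ᴾ Y)) refl refl refl refl

scale-·ʳ : ∀ k x y → x · scale k y ≡ scale k (x · y)
scale-·ʳ k x y = proveᴼ (env k 0ℤ x y y) (X ·ᴾ scaleᴾ K Y) (scaleᴾ K (X ·ᴾ Y)) refl refl refl refl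

scale-scale : ∀ k l x → scale k (scale l x) ≡ scale (k * l) x
scale-scale k l x = proveᴼ (env k l x x x) (scaleᴾ K (scaleᴾ L X)) (scaleᴾ (K :* L) X) refl refl refl refl

-- ℤ-linearity, in the shape that transports x = y + m w, i.e. congruence modulo m.
Linear : (O → O) → Set
Linear f = ∀ k y w → f (y +ᴼ scale k w) ≡ f y +ᴼ scale k (f w)

·-linear : ∀ x → Linear (x ·_)
·-linear x k y w =
  proveᴼ (env k 0ℤ x y w) (X ·ᴾ (Y +ᴾ scaleᴾ K Z)) (X ·ᴾ Y +ᴾ scaleᴾ K (X ·ᴾ Z)) refl refl refl refl

scale-linear : ∀ l → Linear (scale l)
scale-linear l k y w =
  proveᴼ (env k l y y w) (scaleᴾ L (Y +ᴾ scaleᴾ K Z)) (scaleᴾ L Y +ᴾ scaleᴾ K (scaleᴾ L Z)) refl refl refl refl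

-- The units of O

∣_∣² : ℤ → ℕ
∣ t ∣² = ∣ t ∣ ℕ.* ∣ t ∣

square≡∣∣² : ∀ t → t * t ≡ + ∣ t ∣²
square≡∣∣² (+ n)    = ℤ.+◃n≡+n (n ℕ.* n)
square≡∣∣² -[1+ n ] = refl

∣∣²≡0⇒≡0 : ∀ t → ∣ t ∣² ≡ 0 → t ≡ + 0
∣∣²≡0⇒≡0 (+ 0)       _  = refl
∣∣²≡0⇒≡0 (+ ℕ.suc n) ()
∣∣²≡0⇒≡0 -[1+ n ]    ()

norm-sum-of-squares : ∀ a b c d →
  + 4 * (a * a + a * b + + 3 * b * b + + 2 * b * d + + 21 * c * c + + 7 * c * d + d * d) ≡
  (+ 2 * a + b) * (+ 2 * a + b) + (+ 2 * b + + 7 * c + + 2 * d) * (+ 2 * b + + 7 * c + + 2 * d)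
  + + 7 * ((b - + 2 * c) * (b - + 2 * c) + c * c)
norm-sum-of-squares = solve-∀

norm-sum-of-squares-ℕ : ∀ a b c d →
  + 4 * norm ⟨ a , b , c , d ⟩ ≡
  + (∣ + 2 * a + b ∣² ℕ.+ ∣ + 2 * b + + 7 * c + + 2 * d ∣² ℕ.+ 7 ℕ.* (∣ b - + 2 * c ∣² ℕ.+ ∣ c ∣²))
norm-sum-of-squares-ℕ a b c d = begin
  + 4 * norm ⟨ a , b , c , d ⟩
    ≡⟨ norm-sum-of-squares a b c d ⟩
  p * p + q * q + + 7 * (r * r + c * c)
    ≡⟨ cong₂ _+_ (cong₂ _+_ (square≡∣∣² p) (square≡∣∣² q))
                 (cong (_*_ (+ 7)) (cong₂ _+_ (square≡∣∣² r) (square≡∣∣² c))) ⟩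
  + ∣ p ∣² + + ∣ q ∣² + + 7 * (+ ∣ r ∣² + + ∣ c ∣²)
    ≡⟨ cong (_+_ (+ (∣ p ∣² ℕ.+ ∣ q ∣²))) (ℤ.pos-* 7 (∣ r ∣² ℕ.+ ∣ c ∣²)) ⟨
  + (∣ p ∣² ℕ.+ ∣ q ∣² ℕ.+ 7 ℕ.* (∣ r ∣² ℕ.+ ∣ c ∣²)) ∎
  where
  open ≡-Reasoning
  p q r : ℤ
  p = + 2 * a + b
  q = + 2 * b + + 7 * c + + 2 * d
  r = b - + 2 * c

0≤norm : ∀ x → 0ℤ ≤ norm x
0≤norm ⟨ a , b , c , d ⟩ =
  ℤ.*-cancelˡ-≤-pos 0ℤ (norm ⟨ a , b , c , d ⟩) (+ 4) (subst (0ℤ ≤_) (sym (norm-sum-of-squares-ℕ a b c d)) (+≤+ ℕ.z≤n))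

unit⇒norm≡1 : ∀ x y → x · y ≡ oneO → norm x ≡ + 1
unit⇒norm≡1 x y xy≡1 = begin
  norm x        ≡⟨ ℤ.0≤i⇒+∣i∣≡i (0≤norm x) ⟨
  + ∣ norm x ∣  ≡⟨ cong +_ (ℕ.m*n≡1⇒m≡1 ∣ norm x ∣ ∣ norm y ∣ ∣Nx∣∣Ny∣≡1) ⟩
  + 1           ∎
  where
  open ≡-Reasoning
  ∣Nx∣∣Ny∣≡1 : ∣ norm x ∣ ℕ.* ∣ norm y ∣ ≡ 1
  ∣Nx∣∣Ny∣≡1 = trans (sym (ℤ.abs-* (norm x) (norm y))) (cong ∣_∣ (trans (sym (norm-· x y)) (cong norm xy≡1)))

s+7t≡4⇒t≡0 : ∀ s t → s ℕ.+ 7 ℕ.* t ≡ 4 → t ≡ 0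
s+7t≡4⇒t≡0 s 0 _ = refl
s+7t≡4⇒t≡0 s (ℕ.suc t) s+7t≡4 = ⊥-elim (7≰4 (ℕ.≤-trans (ℕ.m≤m*n 7 (ℕ.suc t)) 7t≤4))
  where
  7t≤4 : 7 ℕ.* ℕ.suc t ℕ.≤ 4
  7t≤4 = subst (7 ℕ.* ℕ.suc t ℕ.≤_) s+7t≡4 (ℕ.m≤n+m (7 ℕ.* ℕ.suc t) s)
  7≰4 : ¬ 7 ℕ.≤ 4
  7≰4 (ℕ.s≤s (ℕ.s≤s (ℕ.s≤s (ℕ.s≤s ()))))

norm≡1⇒b≡c≡0 : ∀ a b c d → norm ⟨ a , b , c , d ⟩ ≡ + 1 → b ≡ + 0 × c ≡ + 0
norm≡1⇒b≡c≡0 a b c d N≡1 = b≡0 , c≡0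
  where
  open ≡-Reasoning
  p q r : ℤ
  p = + 2 * a + b
  q = + 2 * b + + 7 * c + + 2 * d
  r = b - + 2 * c
  r²+c²≡0 : ∣ r ∣² ℕ.+ ∣ c ∣² ≡ 0
  r²+c²≡0 = s+7t≡4⇒t≡0 (∣ p ∣² ℕ.+ ∣ q ∣²) (∣ r ∣² ℕ.+ ∣ c ∣²)
              (ℤ.+-injective (trans (sym (norm-sum-of-squares-ℕ a b c d)) (cong (_*_ (+ 4)) N≡1)))
  c≡0 : c ≡ + 0
  c≡0 = ∣∣²≡0⇒≡0 c (ℕ.m+n≡0⇒n≡0 ∣ r ∣² r²+c²≡0)
  r≡0 : r ≡ + 0
  r≡0 = ∣∣²≡0⇒≡0 r (ℕ.m+n≡0⇒m≡0 ∣ r ∣² r²+c²≡0)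
  b≡r+2c : ∀ b c → b ≡ (b - + 2 * c) + + 2 * c
  b≡r+2c = solve-∀
  b≡0 : b ≡ + 0
  b≡0 = begin
    b                         ≡⟨ b≡r+2c b c ⟩
    (b - + 2 * c) + + 2 * c   ≡⟨ cong₂ (λ r t → r + + 2 * t) r≡0 c≡0 ⟩
    + 0                       ∎

m²+n²≡1⇒m≡0⊎n≡0 : ∀ m n → m ℕ.* m ℕ.+ n ℕ.* n ≡ 1 → m ≡ 0 ⊎ n ≡ 0
m²+n²≡1⇒m≡0⊎n≡0 0 n _ = inj₁ refl
m²+n²≡1⇒m≡0⊎n≡0 m 0 _ = inj₂ refl
m²+n²≡1⇒m≡0⊎n≡0 1 (ℕ.suc n) ()
m²+n²≡1⇒m≡0⊎n≡0 (ℕ.suc (ℕ.suc m)) (ℕ.suc n) ()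

norm-diagonal : ∀ a d → norm ⟨ a , + 0 , + 0 , d ⟩ ≡ a * a + d * d
norm-diagonal a d =
  prove (env a d oneO oneO oneO) (normᴾ ⟪ K , con (+ 0) , con (+ 0) , L ⟫) (K :* K :+ L :* L) refl

diagonal-units : ∀ a d → a * a + d * d ≡ + 1 →
                 EqGℤ ⟨ a , + 0 , + 0 , d ⟩ oneO ⊎ EqGℤ ⟨ a , + 0 , + 0 , d ⟩ ω₃
diagonal-units a d a²+d²≡1
  with m²+n²≡1⇒m≡0⊎n≡0 ∣ a ∣ ∣ d ∣
         (ℤ.+-injective (trans (sym (cong₂ _+_ (square≡∣∣² a) (square≡∣∣² d))) a²+d²≡1))
... | inj₂ ∣d∣≡0 with refl ← ℤ.∣i∣≡0⇒i≡0 {d} ∣d∣≡0 =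
  inj₁ (a , (a , trans (sym (ℤ.+-identityʳ (a * a))) a²+d²≡1) ,
        ⟨⟩-cong (sym (ℤ.*-identityʳ a)) (sym (ℤ.*-zeroʳ a)) (sym (ℤ.*-zeroʳ a)) (sym (ℤ.*-zeroʳ a)))
... | inj₁ ∣a∣≡0 with refl ← ℤ.∣i∣≡0⇒i≡0 {a} ∣a∣≡0 =
  inj₂ (d , (d , trans (sym (ℤ.+-identityˡ (d * d))) a²+d²≡1) ,
        ⟨⟩-cong (sym (ℤ.*-zeroʳ d)) (sym (ℤ.*-zeroʳ d)) (sym (ℤ.*-zeroʳ d)) (sym (ℤ.*-identityʳ d)))

units-of-O : ∀ x y → x · y ≡ oneO → EqGℤ x oneO ⊎ EqGℤ x ω₃
units-of-O x@(⟨ a , b , c , d ⟩) y xy≡1 =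
  subst (λ u → EqGℤ u oneO ⊎ EqGℤ u ω₃) (sym x≡diagonal)
        (diagonal-units a d (trans (sym (norm-diagonal a d)) (subst (λ u → norm u ≡ + 1) x≡diagonal N≡1)))
  where
  N≡1 : norm x ≡ + 1
  N≡1 = unit⇒norm≡1 x y xy≡1
  x≡diagonal : x ≡ ⟨ a , + 0 , + 0 , d ⟩
  x≡diagonal = let b≡0 , c≡0 = norm≡1⇒b≡c≡0 a b c d N≡1 in ⟨⟩-cong refl b≡0 c≡0 refl

-- a ≈[ m ] b unfolds to a divisibility of ∣ a - b ∣, from which a and b cannot be inferred;
-- hence the explicit arguments of the congruence lemmas.
≈-via : ∀ a b → + m ℤ.∣ k → a - b ≡ k → a ≈[ m ] b
≈-via _ _ m∣k a-b≡k = ℤ.∣⇒∣ᵤ (subst (_ ℤ.∣_) (sym a-b≡k) m∣k)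

≈⇒∣ : ∀ a b → a ≈[ m ] b → + m ℤ.∣ (a - b)
≈⇒∣ a b = ℤ.∣ᵤ⇒∣ {i = a - b}

≈-refl : ∀ a → a ≈[ m ] a
≈-refl a = ≈-via a a (ℤ.divides 0ℤ refl) (ℤ.+-inverseʳ a)

≈-reflexive : ∀ {a b} → a ≡ b → a ≈[ m ] b
≈-reflexive {a = a} refl = ≈-refl a

≈-sym : ∀ a b → a ≈[ m ] b → b ≈[ m ] a
≈-sym a b a≈b = ≈-via b a (ℤ.∣m⇒∣-m (≈⇒∣ a b a≈b)) (swap a b)
  where
  swap : ∀ a b → b - a ≡ - (a - b)
  swap = solve-∀

≈-trans : ∀ a b c → a ≈[ m ] b → b ≈[ m ] c → a ≈[ m ] c
≈-trans a b c a≈b b≈c = ≈-via a c (ℤ.∣m∣n⇒∣m+n (≈⇒∣ a b a≈b) (≈⇒∣ b c b≈c)) (telescope a b c)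
  where
  telescope : ∀ a b c → a - c ≡ (a - b) + (b - c)
  telescope = solve-∀

≈-*-cong : ∀ a b c d → a ≈[ m ] b → c ≈[ m ] d → a * c ≈[ m ] b * d
≈-*-cong a b c d a≈b c≈d =
  ≈-via (a * c) (b * d) (ℤ.∣m∣n⇒∣m+n (ℤ.∣m⇒∣m*n c (≈⇒∣ a b a≈b)) (ℤ.∣n⇒∣m*n b (≈⇒∣ c d c≈d)))
        (split a b c d)
  where
  split : ∀ a b c d → a * c - b * d ≡ (a - b) * c + b * (c - d)
  split = solve-∀

≈⇒shift : ∀ a b → a ≈[ m ] b → ∃ λ k → a ≡ b + + m * k
≈⇒shift {m} a b a≈b with ℤ.divides k a-b≡k*m ← ≈⇒∣ a b a≈b =
  k , (begin
    a            ≡⟨ a≡b+[a-b] a b ⟩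
    b + (a - b)  ≡⟨ cong (_+_ b) a-b≡k*m ⟩
    b + k * + m  ≡⟨ cong (_+_ b) (ℤ.*-comm k (+ m)) ⟩
    b + + m * k  ∎)
  where
  open ≡-Reasoning
  a≡b+[a-b] : ∀ a b → a ≡ b + (a - b)
  a≡b+[a-b] = solve-∀

shift⇒≈ : ∀ b k → b + + m * k ≈[ m ] b
shift⇒≈ {m} b k = ≈-via (b + + m * k) b (ℤ.divides k refl) (cancel b (+ m) k)
  where
  cancel : ∀ b M k → b + M * k - b ≡ k * M
  cancel = solve-∀

≡O-refl : ∀ x → x ≡O[ m ] x
≡O-refl x = ≈-refl (c0 x) , ≈-refl (c1 x) , ≈-refl (c2 x) , ≈-refl (c3 x)

≡O-reflexive : x ≡ y → x ≡O[ m ] y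
≡O-reflexive {x} refl = ≡O-refl x

≡O-sym : ∀ x y → x ≡O[ m ] y → y ≡O[ m ] x
≡O-sym x y (e₀ , e₁ , e₂ , e₃) =
  ≈-sym (c0 x) (c0 y) e₀ , ≈-sym (c1 x) (c1 y) e₁ , ≈-sym (c2 x) (c2 y) e₂ , ≈-sym (c3 x) (c3 y) e₃

≡O-trans : ∀ x y z → x ≡O[ m ] y → y ≡O[ m ] z → x ≡O[ m ] z
≡O-trans x y z (e₀ , e₁ , e₂ , e₃) (f₀ , f₁ , f₂ , f₃) =
  ≈-trans (c0 x) (c0 y) (c0 z) e₀ f₀ , ≈-trans (c1 x) (c1 y) (c1 z) e₁ f₁ ,
  ≈-trans (c2 x) (c2 y) (c2 z) e₂ f₂ , ≈-trans (c3 x) (c3 y) (c3 z) e₃ f₃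

≡O-setoid : ℕ → Setoid 0ℓ 0ℓ
≡O-setoid m = record
  { Carrier       = O
  ; _≈_           = _≡O[ m ]_
  ; isEquivalence = record
    { refl  = λ {x} → ≡O-refl x
    ; sym   = λ {x} {y} → ≡O-sym x y
    ; trans = λ {x} {y} {z} → ≡O-trans x y z
    }
  }

≡O⇒shift : ∀ x y → x ≡O[ m ] y → ∃ λ w → x ≡ y +ᴼ scale (+ m) w
≡O⇒shift x y (e₀ , e₁ , e₂ , e₃)
  with q₀ , p₀ ← ≈⇒shift (c0 x) (c0 y) e₀ | q₁ , p₁ ← ≈⇒shift (c1 x) (c1 y) e₁
     | q₂ , p₂ ← ≈⇒shift (c2 x) (c2 y) e₂ | q₃ , p₃ ← ≈⇒shift (c3 x) (c3 y) e₃
  = ⟨ q₀ , q₁ , q₂ , q₃ ⟩ , ⟨⟩-cong p₀ p₁ p₂ p₃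

shift⇒≡O : ∀ y w → y +ᴼ scale (+ m) w ≡O[ m ] y
shift⇒≡O y w =
  shift⇒≈ (c0 y) (c0 w) , shift⇒≈ (c1 y) (c1 w) , shift⇒≈ (c2 y) (c2 w) , shift⇒≈ (c3 y) (c3 w)

linear⇒≡O-cong : ∀ f → Linear f → ∀ x y → x ≡O[ m ] y → f x ≡O[ m ] f y
linear⇒≡O-cong {m} f f-linear x y x≡y with w , x≡y+mw ← ≡O⇒shift x y x≡y =
  subst (_≡O[ m ] f y) (sym (trans (cong f x≡y+mw) (f-linear (+ m) y w))) (shift⇒≡O (f y) (f w))

·-congˡ : ∀ v x y → x ≡O[ m ] y → v · x ≡O[ m ] v · y
·-congˡ v = linear⇒≡O-cong (v ·_) (·-linear v)

scale-cong : ∀ l x y → x ≡O[ m ] y → scale l x ≡O[ m ] scale l y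
scale-cong l = linear⇒≡O-cong (scale l) (scale-linear l)

scale-≈1 : ∀ k x → k ≈[ m ] + 1 → scale k x ≡O[ m ] x
scale-≈1 {m} k x k≈1 = k*≈ (c0 x) , k*≈ (c1 x) , k*≈ (c2 x) , k*≈ (c3 x)
  where
  k*≈ : ∀ a → k * a ≈[ m ] a
  k*≈ a = ≈-trans (k * a) (+ 1 * a) a (≈-*-cong k (+ 1) a a k≈1 (≈-refl a)) (≈-reflexive (ℤ.*-identityˡ a))

-- The groups G(ℤ) and G(ℤ/mℤ)

InvertibleMod : ℕ → ℤ → Set
InvertibleMod m l = ∃ λ l′ → l * l′ ≈[ m ] + 1

invertible-* : ∀ k l → InvertibleMod m k → InvertibleMod m l → InvertibleMod m (k * l)
invertible-* {m} k l (k′ , kk′≈1) (l′ , ll′≈1) =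
  k′ * l′ , subst (_≈[ m ] + 1) (rearrange k l k′ l′) (≈-*-cong (k * k′) (+ 1) (l * l′) (+ 1) kk′≈1 ll′≈1)
  where
  rearrange : ∀ k l k′ l′ → (k * k′) * (l * l′) ≡ (k * l) * (k′ * l′)
  rearrange = solve-∀

invertible-neg : ∀ k → InvertibleMod m k → InvertibleMod m (- k)
invertible-neg {m} k (k′ , kk′≈1) = - k′ , subst (_≈[ m ] + 1) (signs-cancel k k′) kk′≈1
  where
  signs-cancel : ∀ k k′ → k * k′ ≡ - k * - k′
  signs-cancel = solve-∀

EqGMod-sym : ∀ x y → EqGMod m x y → EqGMod m y x
EqGMod-sym {m} x y (l , (l′ , ll′≈1) , x≈ly) =
  l′ , (l , l′l≈1) , ≡O-sym (scale l′ x) y (begin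
    scale l′ x            ≈⟨ scale-cong l′ x (scale l y) x≈ly ⟩
    scale l′ (scale l y)  ≡⟨ scale-scale l′ l y ⟩
    scale (l′ * l) y      ≈⟨ scale-≈1 (l′ * l) y l′l≈1 ⟩
    y                     ∎)
  where
  open SetoidReasoning (≡O-setoid m)
  l′l≈1 : l′ * l ≈[ m ] + 1
  l′l≈1 = subst (_≈[ m ] + 1) (ℤ.*-comm l l′) ll′≈1

EqGMod-trans : ∀ x y z → EqGMod m x y → EqGMod m y z → EqGMod m x z
EqGMod-trans {m} x y z (l , l-inv , x≈ly) (k , k-inv , y≈kz) =
  l * k , invertible-* l k l-inv k-inv , (begin
    x                    ≈⟨ x≈ly ⟩
    scale l y            ≈⟨ scale-cong l y (scale k z) y≈kz ⟩
    scale l (scale k z)  ≡⟨ scale-scale l k z ⟩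
    scale (l * k) z      ∎)
  where open SetoidReasoning (≡O-setoid m)

EqGMod-·ˡ : ∀ v x y → EqGMod m x y → EqGMod m (v · x) (v · y)
EqGMod-·ˡ {m} v x y (l , l-inv , x≈ly) =
  l , l-inv , (begin
    v · x            ≈⟨ ·-congˡ v x (scale l y) x≈ly ⟩
    v · scale l y    ≡⟨ scale-·ʳ l v y ⟩
    scale l (v · y)  ∎)
  where open SetoidReasoning (≡O-setoid m)

EqGMod-scale : ∀ n x → InvertibleMod m n → EqGMod m (scale n x) x
EqGMod-scale n x n-inv = n , n-inv , ≡O-refl (scale n x)

EqGℤ⇒EqGMod : EqGℤ x y → EqGMod m x y
EqGℤ⇒EqGMod (l , (l′ , ll′≡1) , x≡ly) = l , (l′ , ≈-reflexive ll′≡1) , ≡O-reflexive x≡ly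

EqGℤ-·ʳ : ∀ x y z → EqGℤ x y → EqGℤ (x · z) (y · z)
EqGℤ-·ʳ x y z (l , l-inv , x≡ly) = l , l-inv , trans (cong (_· z) x≡ly) (scale-·ˡ l y z)

EqGMod-cancelˡ : ∀ x y v z h → y · x ≡ oneO → EqGℤ y v → EqGMod m z (x · h) → EqGMod m h (v · z)
EqGMod-cancelˡ {m} x y v z h yx≡1 y~v z~xh =
  EqGMod-trans h (y · z) (v · z) h~yz (EqGℤ⇒EqGMod (EqGℤ-·ʳ y v z y~v))
  where
  open ≡-Reasoning
  y[xh]≡h : y · (x · h) ≡ h
  y[xh]≡h = begin
    y · (x · h)  ≡⟨ ·-assoc y x h ⟨
    (y · x) · h  ≡⟨ cong (_· h) yx≡1 ⟩
    oneO · h     ≡⟨ ·-identityˡ h ⟩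
    h            ∎
  h~yz : EqGMod m h (y · z)
  h~yz = EqGMod-sym (y · z) h (subst (EqGMod m (y · z)) y[xh]≡h (EqGMod-·ˡ y z (x · h) z~xh))

IsUnitℤ⇒IsUnitMod : IsUnitℤ x → IsUnitMod m x
IsUnitℤ⇒IsUnitMod (y , xy≡1 , yx≡1) = y , ≡O-reflexive xy≡1 , ≡O-reflexive yx≡1

scalar-product⇒IsUnitMod : ∀ x y n → x · y ≡ scale n oneO → y · x ≡ scale n oneO →
                           InvertibleMod m n → IsUnitMod m x
scalar-product⇒IsUnitMod {m} x y n xy≡n yx≡n (k , nk≈1) = scale k y , (begin
    x · scale k y            ≡⟨ scale-·ʳ k x y ⟩
    scale k (x · y)          ≡⟨ cong (scale k) xy≡n ⟩
    scale k (scale n oneO)   ≈⟨ kn≈1 ⟩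
    oneO                     ∎) , (begin
    scale k y · x            ≡⟨ scale-·ˡ k y x ⟩
    scale k (y · x)          ≡⟨ cong (scale k) yx≡n ⟩
    scale k (scale n oneO)   ≈⟨ kn≈1 ⟩
    oneO                     ∎)
  where
  open SetoidReasoning (≡O-setoid m)
  kn≈1 : scale k (scale n oneO) ≡O[ m ] oneO
  kn≈1 = subst (_≡O[ m ] oneO) (sym (scale-scale k n oneO))
           (scale-≈1 (k * n) oneO (subst (_≈[ m ] + 1) (ℤ.*-comm n k) nk≈1))

odd⇒suc≡2* : ∀ m → ¬ 2 ∣ m → ∃ λ k → ℕ.suc m ≡ 2 ℕ.* k
odd⇒suc≡2* 0 2∤0 = ⊥-elim (2∤0 (2 ℕ.∣0))
odd⇒suc≡2* 1 _ = 1 , refl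
odd⇒suc≡2* (ℕ.suc (ℕ.suc m)) 2∤m+2 with k , m+1≡2k ← odd⇒suc≡2* m (2∤m+2 ∘ ℕ.∣m∣n⇒∣m+n ℕ.∣-refl) =
  ℕ.suc k , trans (cong (2 ℕ.+_) m+1≡2k) (sym (ℕ.*-suc 2 k))

odd⇒2-invertible : ¬ 2 ∣ m → InvertibleMod m (+ 2)
odd⇒2-invertible {m} 2∤m with k , m+1≡2k ← odd⇒suc≡2* m 2∤m =
  + k , subst (_≈[ m ] + 1) (sym 2k≡1+m) (shift⇒≈ (+ 1) (+ 1))
  where
  open ≡-Reasoning
  2k≡1+m : + 2 * + k ≡ + 1 + + m * + 1
  2k≡1+m = begin
    + 2 * + k       ≡⟨ ℤ.pos-* 2 k ⟨
    + (2 ℕ.* k)     ≡⟨ cong +_ m+1≡2k ⟨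
    + 1 + + m       ≡⟨ cong (_+_ (+ 1)) (ℤ.*-identityʳ (+ m)) ⟨
    + 1 + + m * + 1 ∎

1+ω₃ 1-ω₃ -1+ω₃ -1-ω₃ : O
1+ω₃  = ⟨ + 1 , + 0 , + 0 , + 1 ⟩
1-ω₃  = ⟨ + 1 , + 0 , + 0 , - + 1 ⟩
-1+ω₃ = ⟨ - + 1 , + 0 , + 0 , + 1 ⟩
-1-ω₃ = ⟨ - + 1 , + 0 , + 0 , - + 1 ⟩

ω₃-unit : IsUnitℤ ω₃
ω₃-unit = ⟨ + 0 , + 0 , + 0 , - + 1 ⟩ , refl , refl

module _ {m : ℕ} {H : O → Set} (pair : CongruencePair m H) where
  open CongruencePair pair
  open IsSubgroupG subgroup

  -- The ω₃-coordinate of ω₃ ≡ l · 1 (mod m) reads 1 ≡ 0 (mod m).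
  ω₃∉H : m ≢ 1 → ¬ H ω₃
  ω₃∉H m≢1 ω₃∈H with l , _ , (_ , _ , _ , 1≈l*0) ← trivial-∩ ω₃ ω₃-unit ω₃∈H =
    m≢1 (ℕ.∣1⇒≡1 (subst (λ t → + 1 ≈[ m ] t) (ℤ.*-zeroʳ l) 1≈l*0))

  square∈H : ∀ w v n → IsUnitMod m v → InvertibleMod m n → w · w ≡ scale n v → H w → H v
  square∈H w v n v-unit n-inv w²≡nv w∈H =
    respect (w · w) v v-unit (subst (λ u → EqGMod m u v) (sym w²≡nv) (EqGMod-scale n v n-inv))
            (mul-cl w w w∈H w∈H)

  module _ (2∤m : ¬ 2 ∣ m) (m≢1 : m ≢ 1) where
    2-invertible : InvertibleMod m (+ 2)
    2-invertible = odd⇒2-invertible 2∤m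

    -- As ω₃² = −1: (±1 + ω₃)(±1 − ω₃) = 2 and (±1 + ω₃)² = ±2 ω₃, by computation.
    1+ω₃-unit : IsUnitMod m 1+ω₃
    1+ω₃-unit = scalar-product⇒IsUnitMod 1+ω₃ 1-ω₃ (+ 2) refl refl 2-invertible

    -1+ω₃-unit : IsUnitMod m -1+ω₃
    -1+ω₃-unit = scalar-product⇒IsUnitMod -1+ω₃ -1-ω₃ (+ 2) refl refl 2-invertible

    1+ω₃∉H : ¬ H 1+ω₃
    1+ω₃∉H = ω₃∉H m≢1 ∘ square∈H 1+ω₃ ω₃ (+ 2) (IsUnitℤ⇒IsUnitMod ω₃-unit) 2-invertible refl

    -1+ω₃∉H : ¬ H -1+ω₃
    -1+ω₃∉H = ω₃∉H m≢1 ∘ square∈H -1+ω₃ ω₃ (- + 2) (IsUnitℤ⇒IsUnitMod ω₃-unit)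
                                   (invertible-neg (+ 2) 2-invertible) refl

    -- ω₃ · 1+ω₃ computes to -1+ω₃.
    cofactor∉H : ∀ x y h → y · x ≡ oneO → EqGMod m 1+ω₃ (x · h) → ¬ H h
    cofactor∉H x y h yx≡1 1+ω₃~xh h∈H = [ in-class-of-1 , in-class-of-ω₃ ]′ (units-of-O y x yx≡1)
      where
      in-class-of-1 : EqGℤ y oneO → ⊥
      in-class-of-1 y~1 =
        1+ω₃∉H (respect h 1+ω₃ 1+ω₃-unit (EqGMod-cancelˡ x y oneO 1+ω₃ h yx≡1 y~1 1+ω₃~xh) h∈H)
      in-class-of-ω₃ : EqGℤ y ω₃ → ⊥
      in-class-of-ω₃ y~ω₃ =
        -1+ω₃∉H (respect h -1+ω₃ -1+ω₃-unit (EqGMod-cancelˡ x y ω₃ 1+ω₃ h yx≡1 y~ω₃ 1+ω₃~xh) h∈H)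

    ¬odd-congruence-pair : ⊥
    ¬odd-congruence-pair =
      let x , (y , _ , yx≡1) , h , h∈H , 1+ω₃~xh = product 1+ω₃ 1+ω₃-unit
      in cofactor∉H x y h yx≡1 1+ω₃~xh h∈H

proposition6p4 : (m : ℕ) → Prime m → ¬ (2 ∣ m) → (H : O → Set) → ¬ CongruencePair m H
proposition6p4 m m-prime 2∤m H pair = ¬odd-congruence-pair pair 2∤m m≢1
  where
  m≢1 : m ≢ 1
  m≢1 m≡1 = ℕ.¬prime[1] (subst Prime m≡1 m-prime)
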